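{- Let $k\ge1$, $L\ge0$, $n=4k\cdot2^L$, $F\in\{0,1\}^n$, $o\in\mathbb{N}$, $R$ a randomness table and $\ell\in\{0,\dots,L\}$. If $F$ has a $k$-bad self-matching in level $\ell$ under $\mathrm{hash}_{R,o}$, then for every integer $k'$ with $1\le k'\le\frac{k}{2}$, $F$ also has a $k'$-bad self-matching $(i_1,\dots,i_{k'}),(i'_1,\dots,i'_{k'})$ in level $\ell$ under $\mathrm{hash}_{R,o}$ with $(i_{k'}-i_1)+(i'_{k'}-i'_1)\le\frac{4k'}{k}n$.
   Context: $R$ is a three-dimensional table of bits $R[p,\ell,i]$. $\mathrm{hash}_{R,o}(S,s,\ell)$ is the $o$-bit string $h_1,\dots,h_o$ with $h_i=\bigoplus_{j=1}^{|S|}(S[j]\cdot R[s+j-1,\ell,i])$, except that if $o>|S|$ it outputs $S$ padded with zeros to length $o$. $S[a,b]$ is the substring from position $a$ to $b$ inclusive. Let $b_\ell=2^{L-\ell}$. For $m\ge1$, an $m$-bad self-matching of $F$ in level $\ell$ consists of indices $i_1\le\dots\le i_m$ and $i'_1\le\dots\le i'_m$ in $[1,n-b_\ell+1]$ such that each $i_j-1$ is a multiple of $b_\ell$, $|i'_j-i'_{j'}|\ge b_\ell$ for $j\neq j'$, and for all $j$: $\mathrm{hash}_{R,o}(F[i_j,i_j+b_\ell-1],i_j-1,\ell)=\mathrm{hash}_{R,o}(F[i'_j,i'_j+b_\ell-1],i_j-1,\ell)$ but $F[i_j,i_j+b_\ell-1]\neq F[i'_j,i'_j+b_\ell-1]$.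 -}

module Defs where

open import Data.Bool using (Bool; true; false; _∧_; _xor_; if_then_else_)
open import Data.Nat using (ℕ; zero; suc; _+_; _*_; _∸_; _^_; _≤_; _<_; _≤ᵇ_; ∣_-_∣)
open import Data.Nat.Divisibility using (_∣_)
open import Data.List using (List; []; _∷_; map; upTo; length; _++_; replicate)
open import Data.Fin using (Fin; zero; suc; fromℕ)
open import Data.Vec using (Vec; []; _∷_)
open import Data.Product using (_×_)
open import Relation.Binary.PropositionalEquality using (_≡_; _≢_)

-- Randomness table: R p ℓ i  (bit R[p,ℓ,i])
Table : Set
Table = ℕ → ℕ → ℕ → Bool

-- ⊕_{j=1}^{|S|} S[j]·R[s+j-1,ℓ,i]  (the current position is s+j-1)
hashBit : Table → ℕ → ℕ → List Bool → ℕ → Bool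
hashBit R ℓ i []      p = false
hashBit R ℓ i (x ∷ S) p = (x ∧ R p ℓ i) xor hashBit R ℓ i S (suc p)

hash : Table → ℕ → List Bool → ℕ → ℕ → List Bool
hash R o S s ℓ =
  if o ≤ᵇ length S
  then map (λ t → hashBit R ℓ (suc t) S s) (upTo o)
  else S ++ replicate (o ∸ length S) false

-- 1-indexed bit access F[p] (false outside 1..n; never used there)
bitAt : ∀ {n} → Vec Bool n → ℕ → Bool
bitAt []       _             = false
bitAt (x ∷ xs) zero          = false
bitAt (x ∷ xs) (suc zero)    = x
bitAt (x ∷ xs) (suc (suc p)) = bitAt xs (suc p)

-- substring F[a, a+b-1] (1-indexed), of length b
substr : ∀ {n} → Vec Bool n → ℕ → ℕ → List Bool
substr F a b = map (λ t → bitAt F (a + t)) (upTo b)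

blk : ℕ → ℕ → ℕ
blk L ℓ = 2 ^ (L ∸ ℓ)

BadSelfMatching : ∀ {n} → Vec Bool n → Table → ℕ → ℕ → ℕ → (m : ℕ) →
                  (Fin m → ℕ) → (Fin m → ℕ) → Set
BadSelfMatching {n} F R o L ℓ m i i' =
  (∀ (j j' : Fin m) → Data.Fin._≤_ j j' → i j ≤ i j') ×
  (∀ (j j' : Fin m) → Data.Fin._≤_ j j' → i' j ≤ i' j') ×
  (∀ (j : Fin m) → 1 ≤ i j × i j ≤ n ∸ blk L ℓ + 1) ×
  (∀ (j : Fin m) → 1 ≤ i' j × i' j ≤ n ∸ blk L ℓ + 1) ×
  (∀ (j : Fin m) → blk L ℓ ∣ (i j ∸ 1)) ×
  (∀ (j j' : Fin m) → j ≢ j' →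
      blk L ℓ ≤ ∣ i' j - i' j' ∣) ×
  (∀ (j : Fin m) →
      hash R o (substr F (i j) (blk L ℓ)) (i j ∸ 1) ℓ
        ≡ hash R o (substr F (i' j) (blk L ℓ)) (i j ∸ 1) ℓ) ×
  (∀ (j : Fin m) → substr F (i j) (blk L ℓ) ≢ substr F (i' j) (blk L ℓ))

firstIx : ∀ {m} → 1 ≤ m → Fin m
firstIx {suc m} _ = zero

lastIx : ∀ {m} → 1 ≤ m → Fin m
lastIx {suc m} _ = fromℕ m

module Submission where

-- Write a bad self-matching of size k as two nondecreasing position
-- sequences a, b : Fin k → ℕ with values in [1, n+1].  Any c = k′ consecutive
-- pairs j = s, …, s+c-1 of a bad self-matching again form a bad self-matching,
-- and its span (a(s+c-1) - a(s)) + (b(s+c-1) - b(s)) is the rise of the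
-- nondecreasing sequence g = a + b across that window.  Choosing m = ⌊k/c⌋,
-- so that m·c ≤ k ≤ 2·m·c, the m disjoint windows starting at 0, c, …, (m-1)·c
-- have rises summing to at most the total rise of g, which is at most 2n; so
-- the flattest of them rises by at most 2n/m ≤ 4cn/k.

open import Defs
open import Data.Bool using (Bool)
open import Data.Nat using (ℕ; zero; suc; _+_; _*_; _∸_; _^_; _≤_; _<_; z≤n; s≤s; _≤?_; _<?_; NonZero)
open import Data.Nat.Properties
open import Data.Nat.DivMod using (_/_; _%_; m≡m%n+[m/n]*n; m%n<n; m/n*n≤m; m≥n⇒m/n>0)
open import Data.Nat.Solver using (module +-*-Solver)
open import Algebra.Properties.CommutativeSemigroup +-commutativeSemigroup using (interchange)
open import Data.Vec using (Vec)
open import Data.Fin using (Fin; toℕ; fromℕ; fromℕ<)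
import Data.Fin as Fin
import Data.Fin.Properties as FinP
open import Data.Product using (Σ; _×_; _,_; proj₁; proj₂)
open import Function using (_∘_)
open import Relation.Binary.PropositionalEquality
open import Relation.Nullary using (yes; no; contradiction)

open +-*-Solver using (solve; _:=_; _:+_; _:*_; con)

∸-+-interchange : ∀ {x x′ y y′} → x ≤ x′ → y ≤ y′ → (x′ ∸ x) + (y′ ∸ y) ≡ (x′ + y′) ∸ (x + y)
∸-+-interchange {x} {x′} {y} {y′} x≤x′ y≤y′ = sym (begin
  (x′ + y′) ∸ (x + y)  ≡⟨ sym (∸-+-assoc (x′ + y′) x y) ⟩
  (x′ + y′) ∸ x ∸ y    ≡⟨ cong (_∸ y) (+-∸-comm y′ x≤x′) ⟩
  ((x′ ∸ x) + y′) ∸ y  ≡⟨ +-∸-assoc (x′ ∸ x) y≤y′ ⟩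
  (x′ ∸ x) + (y′ ∸ y)  ∎)
  where open ≡-Reasoning

-- Every k ≥ c lies between m·c and 2·m·c for some m ≥ 1, namely m = ⌊k/c⌋
-- (the positivity of ⌊k/c⌋ rules out m = 0).
quotient-bracket : ∀ k c .{{_ : NonZero c}} → c ≤ k →
                   Σ ℕ λ q → suc q * c ≤ k × k ≤ 2 * (suc q * c)
quotient-bracket k c c≤k
  with k / c | m/n*n≤m k c | m≥n⇒m/n>0 {k} {c} c≤k | m≡m%n+[m/n]*n k c
... | suc q | mc≤k | _ | k≡r+mc = q , mc≤k , (begin
  k                      ≡⟨ k≡r+mc ⟩
  k % c + suc q * c      ≤⟨ +-monoˡ-≤ (suc q * c) (≤-trans (<⇒≤ (m%n<n k c)) (m≤m+n c (q * c))) ⟩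
  suc q * c + suc q * c  ≡⟨ cong (suc q * c +_) (sym (+-identityʳ (suc q * c))) ⟩
  2 * (suc q * c)        ∎)
  where open ≤-Reasoning

MonotoneBelow : ℕ → (ℕ → ℕ) → Set
MonotoneBelow N g = ∀ {x y} → x ≤ y → y < N → g x ≤ g y

module Windows (g : ℕ → ℕ) (p : ℕ) where

  c : ℕ
  c = suc p

  rise : ℕ → ℕ
  rise s = g (s + p) ∸ g s

  append-window : ∀ q X → MonotoneBelow (suc (suc q * c + p)) g →
                  X + g 0 ≤ g (q * c + p) → rise (suc q * c) + X + g 0 ≤ g (suc q * c + p)
  append-window q X mono X≤ = begin
    rise s + X + g 0      ≡⟨ +-assoc (rise s) X (g 0) ⟩
    rise s + (X + g 0)    ≤⟨ +-monoʳ-≤ (rise s) (≤-trans X≤ (mono end≤s (s≤s (m≤m+n s p)))) ⟩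
    rise s + g s          ≡⟨ m∸n+n≡m (mono (m≤m+n s p) ≤-refl) ⟩
    g (s + p)             ∎
    where
      open ≤-Reasoning
      s = suc q * c
      end≤s : q * c + p ≤ s
      end≤s = ≤-trans (≤-reflexive (+-comm (q * c) p)) (n≤1+n (p + q * c))

  flattest-window : ∀ q → MonotoneBelow (suc (q * c + p)) g →
                    Σ ℕ λ w → w ≤ q × suc q * rise (w * c) + g 0 ≤ g (q * c + p)
  flattest-window zero mono =
    0 , z≤n , ≤-reflexive (trans (cong (_+ g 0) (+-identityʳ (rise 0))) (m∸n+n≡m (mono z≤n ≤-refl)))
  flattest-window (suc q) mono
    with flattest-window q (λ x≤y y<N → mono x≤y (≤-trans y<N (s≤s (+-monoˡ-≤ p (m≤n+m (q * c) c)))))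
  ... | w , w≤q , flat with rise (suc q * c) ≤? rise (w * c)
  ... | yes new≤old = suc q , ≤-refl ,
        append-window q _ mono (≤-trans (+-monoˡ-≤ (g 0) (*-monoʳ-≤ (suc q) new≤old)) flat)
  ... | no  new≰old = w , m≤n⇒m≤1+n w≤q ,
        ≤-trans (+-monoˡ-≤ (g 0) (+-monoˡ-≤ (suc q * rise (w * c)) (<⇒≤ (≰⇒> new≰old))))
                (append-window q _ mono flat)

  last-point-inside : ∀ q {k} → suc q * c ≤ k → q * c + p < k
  last-point-inside q qc≤k = ≤-trans (s≤s (≤-reflexive (+-comm (q * c) p))) qc≤k

  short-window : ∀ k B → c ≤ k → MonotoneBelow k g → (∀ {x} → x < k → g x ≤ g 0 + B) →
                 Σ ℕ λ s → s + c ≤ k × k * rise s ≤ 2 * c * B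
  short-window k B c≤k mono bounded with quotient-bracket k c c≤k
  ... | q , qc≤k , k≤2qc with flattest-window q (λ x≤y y<N → mono x≤y (≤-trans y<N (last-point-inside q qc≤k)))
  ... | w , w≤q , flat = w * c , inside , (begin
    k * rise s                ≤⟨ *-monoˡ-≤ (rise s) k≤2qc ⟩
    2 * (suc q * c) * rise s  ≡⟨ solve 3 (λ m c r → con 2 :* (m :* c) :* r := con 2 :* c :* (m :* r))
                                         refl (suc q) c (rise s) ⟩
    2 * c * (suc q * rise s)  ≤⟨ *-monoʳ-≤ (2 * c) few ⟩
    2 * c * B                 ∎)
    where
      open ≤-Reasoning
      s = w * c
      inside : s + c ≤ k
      inside = ≤-trans (+-monoˡ-≤ c (*-monoˡ-≤ c w≤q)) (≤-trans (≤-reflexive (+-comm (q * c) c)) qc≤k)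
      few : suc q * rise s ≤ B
      few = +-cancelˡ-≤ (g 0) _ _
              (≤-trans (≤-reflexive (+-comm (g 0) _)) (≤-trans flat (bounded (last-point-inside q qc≤k))))

extend : ∀ {k} → (Fin k → ℕ) → ℕ → ℕ
extend {k} a x with x <? k
... | yes x<k = a (fromℕ< x<k)
... | no  _   = 0

extend-fromℕ< : ∀ {k} (a : Fin k → ℕ) {x} (x<k : x < k) → extend a x ≡ a (fromℕ< x<k)
extend-fromℕ< {k} a {x} x<k with x <? k
... | yes _   = refl
... | no  x≮k = contradiction x<k x≮k

MonotoneFin : ∀ {k} → (Fin k → ℕ) → Set
MonotoneFin {k} a = ∀ (j j′ : Fin k) → j Fin.≤ j′ → a j ≤ a j′

extend-monotone : ∀ {k} {a : Fin k → ℕ} → MonotoneFin a → MonotoneBelow k (extend a)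
extend-monotone {a = a} mono x≤y y<k =
  subst₂ _≤_ (sym (extend-fromℕ< a x<k)) (sym (extend-fromℕ< a y<k))
    (mono _ _ (subst₂ _≤_ (sym (FinP.toℕ-fromℕ< x<k)) (sym (FinP.toℕ-fromℕ< y<k)) x≤y))
  where
    x<k = ≤-<-trans x≤y y<k

extend-bounded : ∀ {k n b} {a : Fin k → ℕ} → (∀ j → 1 ≤ a j × a j ≤ n ∸ b + 1) →
                 ∀ {x} → x < k → extend a x ≤ extend a 0 + n
extend-bounded {k} {n} {b} {a} range {x} x<k = begin
  extend a x        ≡⟨ extend-fromℕ< a x<k ⟩
  a (fromℕ< x<k)    ≤⟨ proj₂ (range _) ⟩
  n ∸ b + 1         ≤⟨ +-monoˡ-≤ 1 (m∸n≤m n b) ⟩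
  n + 1             ≡⟨ +-comm n 1 ⟩
  1 + n             ≤⟨ +-monoˡ-≤ n (proj₁ (range _)) ⟩
  a (fromℕ< 0<k) + n ≡⟨ cong (_+ n) (sym (extend-fromℕ< a 0<k)) ⟩
  extend a 0 + n    ∎
  where
    open ≤-Reasoning
    0<k : 0 < k
    0<k = ≤-<-trans z≤n x<k

combined : ∀ {k} → (Fin k → ℕ) → (Fin k → ℕ) → ℕ → ℕ
combined a b x = extend a x + extend b x

combined-monotone : ∀ {k} {a b : Fin k → ℕ} → MonotoneFin a → MonotoneFin b → MonotoneBelow k (combined a b)
combined-monotone mono-a mono-b x≤y y<k = +-mono-≤ (extend-monotone mono-a x≤y y<k) (extend-monotone mono-b x≤y y<k)

combined-bounded : ∀ {k n b} {a a′ : Fin k → ℕ} →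
                   (∀ j → 1 ≤ a j × a j ≤ n ∸ b + 1) → (∀ j → 1 ≤ a′ j × a′ j ≤ n ∸ b + 1) →
                   ∀ {x} → x < k → combined a a′ x ≤ combined a a′ 0 + (n + n)
combined-bounded {n = n} {b} {a} {a′} range range′ x<k =
  ≤-trans (+-mono-≤ (extend-bounded {b = b} range x<k) (extend-bounded {b = b} range′ x<k))
          (≤-reflexive (interchange (extend a 0) n (extend a′ 0) n))

window-bound : ∀ {k c} s → s + c ≤ k → (t : Fin c) → s + toℕ t < k
window-bound s inside t = ≤-trans (+-monoʳ-< s (FinP.toℕ<n t)) inside

window : ∀ {k c} s → s + c ≤ k → Fin c → Fin k
window s inside t = fromℕ< (window-bound s inside t)

window-toℕ : ∀ {k c} s (inside : s + c ≤ k) t → toℕ (window s inside t) ≡ s + toℕ t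
window-toℕ s inside t = FinP.toℕ-fromℕ< _

extend-window : ∀ {k c} (a : Fin k → ℕ) s (inside : s + c ≤ k) t →
                a (window s inside t) ≡ extend a (s + toℕ t)
extend-window a s inside t = sym (extend-fromℕ< a (window-bound s inside t))

restrict : ∀ {n} (F : Vec Bool n) R o L ℓ {k k′} {i i′ : Fin k → ℕ} (e : Fin k′ → Fin k) →
           (∀ j j′ → j Fin.≤ j′ → e j Fin.≤ e j′) → (∀ j j′ → e j ≡ e j′ → j ≡ j′) →
           BadSelfMatching F R o L ℓ k i i′ → BadSelfMatching F R o L ℓ k′ (i ∘ e) (i′ ∘ e)
restrict F R o L ℓ e e-mono e-inj (mono , mono′ , range , range′ , aligned , apart , collide , differ) =
  (λ j j′ le → mono (e j) (e j′) (e-mono j j′ le)) ,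
  (λ j j′ le → mono′ (e j) (e j′) (e-mono j j′ le)) ,
  range ∘ e , range′ ∘ e , aligned ∘ e ,
  (λ j j′ j≢j′ → apart (e j) (e j′) (j≢j′ ∘ e-inj j j′)) ,
  collide ∘ e , differ ∘ e

restrict-window : ∀ {n} (F : Vec Bool n) R o L ℓ {k c} {i i′ : Fin k → ℕ} s (inside : s + c ≤ k) →
                  BadSelfMatching F R o L ℓ k i i′ →
                  BadSelfMatching F R o L ℓ c (i ∘ window s inside) (i′ ∘ window s inside)
restrict-window F R o L ℓ s inside = restrict F R o L ℓ (window s inside) monotone injective
  where
    monotone : ∀ j j′ → j Fin.≤ j′ → window s inside j Fin.≤ window s inside j′
    monotone j j′ le = subst₂ _≤_ (sym (window-toℕ s inside j)) (sym (window-toℕ s inside j′)) (+-monoʳ-≤ s le)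
    injective : ∀ j j′ → window s inside j ≡ window s inside j′ → j ≡ j′
    injective j j′ eq = FinP.toℕ-injective (+-cancelˡ-≡ s _ _
      (trans (sym (window-toℕ s inside j)) (trans (cong toℕ eq) (window-toℕ s inside j′))))

window-span : ∀ {k p} {a b : Fin k → ℕ} → MonotoneFin a → MonotoneFin b → ∀ s (inside : s + suc p ≤ k) →
              let e = window s inside in
              (a (e (fromℕ p)) ∸ a (e Fin.zero)) + (b (e (fromℕ p)) ∸ b (e Fin.zero))
                ≡ Windows.rise (combined a b) p s
window-span {k} {p} {a} {b} mono-a mono-b s inside = begin
  (a (e (fromℕ p)) ∸ a (e Fin.zero)) + (b (e (fromℕ p)) ∸ b (e Fin.zero))
    ≡⟨ cong₂ _+_ (cong₂ _∸_ (last a) (first a)) (cong₂ _∸_ (last b) (first b)) ⟩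
  (extend a (s + p) ∸ extend a s) + (extend b (s + p) ∸ extend b s)
    ≡⟨ ∸-+-interchange (extend-monotone mono-a (m≤m+n s p) s+p<k) (extend-monotone mono-b (m≤m+n s p) s+p<k) ⟩
  (extend a (s + p) + extend b (s + p)) ∸ (extend a s + extend b s) ∎
  where
    open ≡-Reasoning
    e = window s inside
    s+p<k : s + p < k
    s+p<k = ≤-trans (≤-reflexive (sym (+-suc s p))) inside
    at : ∀ (f : Fin k → ℕ) t x → toℕ t ≡ x → f (e t) ≡ extend f (s + x)
    at f t x t≡x = trans (extend-window f s inside t) (cong (λ y → extend f (s + y)) t≡x)
    last : ∀ (f : Fin k → ℕ) → f (e (fromℕ p)) ≡ extend f (s + p)
    last f = at f (fromℕ p) p (FinP.toℕ-fromℕ p)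
    first : ∀ (f : Fin k → ℕ) → f (e Fin.zero) ≡ extend f s
    first f = trans (at f Fin.zero 0 refl) (cong (extend f) (+-identityʳ s))

lemma9 : (k L : ℕ) → 1 ≤ k → (F : Vec Bool (4 * k * 2 ^ L)) → (o : ℕ) → (R : Table) →
    (ℓ : ℕ) → ℓ ≤ L →
    (Σ (Fin k → ℕ) λ i → Σ (Fin k → ℕ) λ i' → BadSelfMatching F R o L ℓ k i i') →
    (k′ : ℕ) → (h : 1 ≤ k′) → 2 * k′ ≤ k →
    Σ (Fin k′ → ℕ) λ i → Σ (Fin k′ → ℕ) λ i' →
    BadSelfMatching F R o L ℓ k′ i i' ×
    k * ((i (lastIx h) ∸ i (firstIx h)) + (i' (lastIx h) ∸ i' (firstIx h)))
    ≤ 4 * k′ * (4 * k * 2 ^ L)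
lemma9 k L _ F o R ℓ _ (i , i′ , bad@(mono , mono′ , range , range′ , _)) (suc p) _ 2c≤k =
  conclude (Windows.short-window (combined i i′) p k (n + n) c≤k
              (combined-monotone mono mono′) (combined-bounded {b = blk L ℓ} range range′))
  where
    n = 4 * k * 2 ^ L
    c≤k : suc p ≤ k
    c≤k = ≤-trans (m≤m+n (suc p) (suc p + 0)) 2c≤k
    conclude : (Σ ℕ λ s → s + suc p ≤ k × k * Windows.rise (combined i i′) p s ≤ 2 * suc p * (n + n)) →
               Σ (Fin (suc p) → ℕ) λ j → Σ (Fin (suc p) → ℕ) λ j′ →
                 BadSelfMatching F R o L ℓ (suc p) j j′ ×
                 k * ((j (fromℕ p) ∸ j Fin.zero) + (j′ (fromℕ p) ∸ j′ Fin.zero)) ≤ 4 * suc p * n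
    conclude (s , inside , short) = i ∘ e , i′ ∘ e , restrict-window F R o L ℓ s inside bad , (begin
      k * ((i (e (fromℕ p)) ∸ i (e Fin.zero)) + (i′ (e (fromℕ p)) ∸ i′ (e Fin.zero)))
        ≡⟨ cong (k *_) (window-span mono mono′ s inside) ⟩
      k * Windows.rise (combined i i′) p s  ≤⟨ short ⟩
      2 * suc p * (n + n)                   ≡⟨ solve 2 (λ c n → con 2 :* c :* (n :+ n) := con 4 :* c :* n)
                                                       refl (suc p) n ⟩
      4 * suc p * n                         ∎)
      where
        open ≤-Reasoning
        e = window s inside
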